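{- Let $\mathcal{T}$ be a consistent typed combinatory algebra. Then (i) the map $\mathbb{N}\to|N|$, $n\mapsto\overline{n}$, is injective; and (ii) for all types $A,B$, the maps $|A|\to|A+B|$, $a\mapsto\mathsf{inl}\,a$, and $|B|\to|A+B|$, $b\mapsto\mathsf{inr}\,b$, have disjoint images.
   Context: A typed combinatory algebra (tca) $\mathcal{T}$ consists of a set of types containing distinguished types $\bot,\top,N$ and closed under binary operations $\times,\to,+$; for each type $T$ a set $|T|$; and total application maps $|S\to T|\times|S|\to|T|$, $(a,b)\mapsto ab$ (left associative), such that for all types $S,T,U$ there are elements $\mathsf{exf}\in|\bot\to S|$, $\mathsf{t}\in|\top|$, $\mathsf{k}\in|S\to T\to S|$, $\mathsf{s}\in|(S\to T\to U)\to(S\to T)\to(S\to U)|$, $\mathsf{pair}\in|S\to T\to S\times T|$, $\mathsf{fst}\in|S\times T\to S|$, $\mathsf{snd}\in|S\times T\to T|$, $\mathsf{inl}\in|S\to S+T|$, $\mathsf{inr}\in|T\to S+T|$, $\mathsf{case}\in|(S\to U)\to(T\to U)\to(S+T\to U)|$, $\mathsf{0}\in|N|$, $\mathsf{succ}\in|N\to N|$, $\mathsf{R}\in|S\to(N\to(S\to S))\to(N\to S)|$ satisfying $\mathsf{k}ab=a$, $\mathsf{s}abc=ac(bc)$, $\mathsf{fst}(\mathsf{pair}ab)=a$, $\mathsf{snd}(\mathsf{pair}ab)=b$, $\mathsf{case}ab(\mathsf{inl}x)=ax$, $\mathsf{case}ab(\mathsf{inr}x)=bx$, $\mathsf{R}ab\mathsf{0}=a$,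 $\mathsf{R}ab(\mathsf{succ}n)=bn(\mathsf{R}abn)$. Numerals: $\overline n=\mathsf{succ}^n\mathsf 0$. $\mathcal T$ is consistent if $\mathsf 0\ne\mathsf{succ}\,\mathsf 0$. -}

module Defs where

open import Data.Nat using (ℕ; zero; suc)
open import Relation.Binary.PropositionalEquality using (_≡_)
open import Relation.Nullary using (¬_)

record TCA : Set₁ where
  infixr 7 _⇒_
  infixl 9 _·_
  field
    Ty   : Set
    ⊥ᵗ ⊤ᵗ Nᵗ : Ty
    _⊗_ _⇒_ _⊕_ : Ty → Ty → Ty
    ∣_∣  : Ty → Set
    _·_  : ∀ {S T} → ∣ S ⇒ T ∣ → ∣ S ∣ → ∣ T ∣
    exf  : ∀ {S} → ∣ ⊥ᵗ ⇒ S ∣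
    t    : ∣ ⊤ᵗ ∣
    k    : ∀ {S T} → ∣ S ⇒ T ⇒ S ∣
    s    : ∀ {S T U} → ∣ (S ⇒ T ⇒ U) ⇒ (S ⇒ T) ⇒ (S ⇒ U) ∣
    pair : ∀ {S T} → ∣ S ⇒ T ⇒ (S ⊗ T) ∣
    fst  : ∀ {S T} → ∣ (S ⊗ T) ⇒ S ∣
    snd  : ∀ {S T} → ∣ (S ⊗ T) ⇒ T ∣
    inl  : ∀ {S T} → ∣ S ⇒ (S ⊕ T) ∣
    inr  : ∀ {S T} → ∣ T ⇒ (S ⊕ T) ∣
    case : ∀ {S T U} → ∣ (S ⇒ U) ⇒ (T ⇒ U) ⇒ ((S ⊕ T) ⇒ U) ∣
    0ᶜ   : ∣ Nᵗ ∣
    succ : ∣ Nᵗ ⇒ Nᵗ ∣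
    R    : ∀ {S} → ∣ S ⇒ (Nᵗ ⇒ (S ⇒ S)) ⇒ (Nᵗ ⇒ S) ∣
    k-eq    : ∀ {S T} (a : ∣ S ∣) (b : ∣ T ∣) → k · a · b ≡ a
    s-eq    : ∀ {S T U} (a : ∣ S ⇒ T ⇒ U ∣) (b : ∣ S ⇒ T ∣) (c : ∣ S ∣) →
              s · a · b · c ≡ (a · c) · (b · c)
    fst-eq  : ∀ {S T} (a : ∣ S ∣) (b : ∣ T ∣) → fst · (pair · a · b) ≡ a
    snd-eq  : ∀ {S T} (a : ∣ S ∣) (b : ∣ T ∣) → snd · (pair · a · b) ≡ b
    case-inl : ∀ {S T U} (a : ∣ S ⇒ U ∣) (b : ∣ T ⇒ U ∣) (x : ∣ S ∣) →
               case · a · b · (inl · x) ≡ a · x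
    case-inr : ∀ {S T U} (a : ∣ S ⇒ U ∣) (b : ∣ T ⇒ U ∣) (x : ∣ T ∣) →
               case · a · b · (inr · x) ≡ b · x
    R-zero  : ∀ {S} (a : ∣ S ∣) (b : ∣ Nᵗ ⇒ (S ⇒ S) ∣) → R · a · b · 0ᶜ ≡ a
    R-succ  : ∀ {S} (a : ∣ S ∣) (b : ∣ Nᵗ ⇒ (S ⇒ S) ∣) (n : ∣ Nᵗ ∣) →
              R · a · b · (succ · n) ≡ b · n · (R · a · b · n)

  numeral : ℕ → ∣ Nᵗ ∣
  numeral zero    = 0ᶜ
  numeral (suc n) = succ · numeral n

  Consistent : Set
  Consistent = ¬ (0ᶜ ≡ succ · 0ᶜ)

module Submission where

open import Defs
open import Data.Nat using (ℕ; zero; suc)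
open import Data.Product using (_×_; _,_)
open import Relation.Binary.PropositionalEquality
  using (_≡_; refl; sym; cong; module ≡-Reasoning)
open import Relation.Nullary using (¬_)

-- Both parts reduce to consistency: primitive recursion defines a sign function,
-- which would identify 0 and 1 if some successor equalled 0, and a predecessor,
-- which makes succ injective; case analysis with the constant maps 0 and 1
-- would likewise identify 0 and 1 if some inl a equalled some inr b.

module TCAProperties (𝒯 : TCA) where
  open TCA 𝒯
  open ≡-Reasoning

  sign : ∣ Nᵗ ⇒ Nᵗ ∣
  sign = R · 0ᶜ · (k · (k · (succ · 0ᶜ)))

  sign-0 : sign · 0ᶜ ≡ 0ᶜ
  sign-0 = R-zero 0ᶜ _

  sign-succ : ∀ x → sign · (succ · x) ≡ succ · 0ᶜ
  sign-succ x = begin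
    sign · (succ · x)                       ≡⟨ R-succ 0ᶜ _ x ⟩
    k · (k · (succ · 0ᶜ)) · x · (sign · x)  ≡⟨ cong (_· (sign · x)) (k-eq _ x) ⟩
    k · (succ · 0ᶜ) · (sign · x)            ≡⟨ k-eq _ _ ⟩
    succ · 0ᶜ                               ∎

  pred : ∣ Nᵗ ⇒ Nᵗ ∣
  pred = R · 0ᶜ · k

  pred-succ : ∀ x → pred · (succ · x) ≡ x
  pred-succ x = begin
    pred · (succ · x)   ≡⟨ R-succ 0ᶜ k x ⟩
    k · x · (pred · x)  ≡⟨ k-eq x _ ⟩
    x                   ∎

  succ-injective : ∀ {x y} → succ · x ≡ succ · y → x ≡ y
  succ-injective {x} {y} eq = begin
    x                  ≡⟨ sym (pred-succ x) ⟩
    pred · (succ · x)  ≡⟨ cong (pred ·_) eq ⟩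
    pred · (succ · y)  ≡⟨ pred-succ y ⟩
    y                  ∎

  0≡succ⇒0≡1 : ∀ {x} → 0ᶜ ≡ succ · x → 0ᶜ ≡ succ · 0ᶜ
  0≡succ⇒0≡1 {x} eq = begin
    0ᶜ                 ≡⟨ sym sign-0 ⟩
    sign · 0ᶜ          ≡⟨ cong (sign ·_) eq ⟩
    sign · (succ · x)  ≡⟨ sign-succ x ⟩
    succ · 0ᶜ          ∎

  inl≡inr⇒0≡1 : ∀ {A B} {a : ∣ A ∣} {b : ∣ B ∣} →
                inl {A} {B} · a ≡ inr · b → 0ᶜ ≡ succ · 0ᶜ
  inl≡inr⇒0≡1 {A} {B} {a} {b} eq = begin
    0ᶜ                   ≡⟨ sym (k-eq 0ᶜ a) ⟩
    k · 0ᶜ · a           ≡⟨ sym (case-inl _ _ a) ⟩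
    isRight · (inl · a)  ≡⟨ cong (isRight ·_) eq ⟩
    isRight · (inr · b)  ≡⟨ case-inr _ _ b ⟩
    k · (succ · 0ᶜ) · b  ≡⟨ k-eq _ b ⟩
    succ · 0ᶜ            ∎
    where
    isRight : ∣ (A ⊕ B) ⇒ Nᵗ ∣
    isRight = case · (k · 0ᶜ) · (k · (succ · 0ᶜ))

  module _ (consistent : Consistent) where

    0≢succ : ∀ x → ¬ (0ᶜ ≡ succ · x)
    0≢succ x eq = consistent (0≡succ⇒0≡1 eq)

    numeral-injective : (m n : ℕ) → numeral m ≡ numeral n → m ≡ n
    numeral-injective zero    zero    _  = refl
    numeral-injective zero    (suc n) eq with () ← 0≢succ _ eq
    numeral-injective (suc m) zero    eq with () ← 0≢succ _ (sym eq)
    numeral-injective (suc m) (suc n) eq =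
      cong suc (numeral-injective m n (succ-injective eq))

    inl≢inr : (A B : Ty) (a : ∣ A ∣) (b : ∣ B ∣) → ¬ (inl {A} {B} · a ≡ inr · b)
    inl≢inr A B a b eq = consistent (inl≡inr⇒0≡1 eq)

mainTheorem17 : (𝒯 : TCA) → TCA.Consistent 𝒯 →
    ((m n : ℕ) → TCA.numeral 𝒯 m ≡ TCA.numeral 𝒯 n → m ≡ n)
    × ((A B : TCA.Ty 𝒯) (a : TCA.∣_∣ 𝒯 A) (b : TCA.∣_∣ 𝒯 B) →
    ¬ (TCA._·_ 𝒯 (TCA.inl 𝒯 {A} {B}) a ≡ TCA._·_ 𝒯 (TCA.inr 𝒯 {A} {B}) b))
mainTheorem17 𝒯 consistent =
  numeral-injective consistent , inl≢inr consistent
  where open TCAProperties 𝒯
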